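{- Let $\mathcal{H}\subseteq 2^V$ be a hypergraph satisfying properties (A) and (C). Then for every position $\mathbf{x}\in\mathbb{Z}_+^V$ with $m(\mathbf{x})>0$ and every pair of integers $(\mu,\eta)\neq(m(\mathbf{x}),y_\mathcal{H}(\mathbf{x}))$ with $0\leq\mu\leq m(\mathbf{x})$ and $m(\mathbf{x})-\mu\leq\eta\leq y_\mathcal{H}(\mathbf{x})$, there exists a move $\mathbf{x}\to\mathbf{x}'$ of Nim$_\mathcal{H}$ with $m(\mathbf{x}')=\mu$ and $y_\mathcal{H}(\mathbf{x}')=\eta$.
   Context: A hypergraph on a finite set $V$ is a family $\mathcal{H}\subseteq 2^V$ of nonempty edges covering $V$. In Nim$_\mathcal{H}$ a move $\mathbf{x}\to\mathbf{x}'$ ($\mathbf{x},\mathbf{x}'\in\mathbb{Z}_+^V$) chooses $H\in\mathcal{H}$ and has $x'_i<x_i$ for $i\in H$, $x'_i=x_i$ for $i\notin H$. Height $h_\mathcal{H}(\mathbf{x})$: maximum number of consecutive moves from $\mathbf{x}$. $m(\mathbf{x})=\min_ix_i$; $y_\mathcal{H}(\mathbf{x})=h_\mathcal{H}(\mathbf{x}-m(\mathbf{x})\mathbf{e})$, $\mathbf{e}$ all-ones. (A): $\mathcal{H}$ has no edge meeting all edges of $\mathcal{H}$, but for every proper $S\subsetneq V$ with $\mathcal{H}_S=\{H\in\mathcal{H}\mid H\subseteq S\}\neq\emptyset$, some edge of $\mathcal{H}_S$ meets all edges of $\mathcal{H}_S$. (C): for any two distinct edges $H,H'$ there are edges $H=H_0,\dots,H_q=H'$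 with $H_{i+1}\cap H_i\neq\emptyset$, $|H_{i+1}\setminus H_i|=1$, $H_i\subseteq H_0\cup H_q$ for $i=0,\dots,q-1$. -}

module Defs where

open import Data.Nat using (ℕ; zero; suc; _≤_; _<_; _∸_)
open import Data.Fin using (Fin)
open import Data.Fin.Subset using (Subset; _∈_; _∉_; _⊆_; _∪_; _─_; ∣_∣; Nonempty)
open import Data.List using (List)
import Data.List.Membership.Propositional as LM
open import Data.Product using (Σ; ∃; _×_; _,_)
open import Relation.Binary.PropositionalEquality using (_≡_)
open import Relation.Nullary using (¬_)

-- Vertex set V = Fin n; an edge is a subset of Fin n; a hypergraph is a
-- (finite) list of edges (duplicates are harmless: only membership is used).
Edge : ℕ → Set
Edge n = Subset n

Pos : ℕ → Set
Pos n = Fin n → ℕ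

module _ {n : ℕ} where

  _∈ℋ_ : Edge n → List (Edge n) → Set
  E ∈ℋ ℋ = E LM.∈ ℋ

  Meets : Edge n → Edge n → Set
  Meets E E' = ∃ λ i → i ∈ E × i ∈ E'

  IsHypergraph : List (Edge n) → Set
  IsHypergraph ℋ = (∀ E → E ∈ℋ ℋ → Nonempty E)
                 × (∀ (i : Fin n) → ∃ λ E → E ∈ℋ ℋ × i ∈ E)

  PropA : List (Edge n) → Set
  PropA ℋ =
      ¬ (∃ λ E → E ∈ℋ ℋ × (∀ E' → E' ∈ℋ ℋ → Meets E E'))
    × (∀ (S : Subset n) → (∃ λ i → i ∉ S)
         → (∃ λ E → E ∈ℋ ℋ × E ⊆ S)
         → ∃ λ E → E ∈ℋ ℋ × E ⊆ S
              × (∀ E' → E' ∈ℋ ℋ → E' ⊆ S → Meets E E'))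

  data Chain (ℋ : List (Edge n)) (U : Subset n) : Edge n → Edge n → Set where
    done : ∀ {B} → Chain ℋ U B B
    step : ∀ {A A' B} → A ∈ℋ ℋ → A' ∈ℋ ℋ → A ⊆ U → Meets A' A
         → ∣ A' ─ A ∣ ≡ 1 → Chain ℋ U A' B → Chain ℋ U A B

  PropC : List (Edge n) → Set
  PropC ℋ = ∀ H H' → H ∈ℋ ℋ → H' ∈ℋ ℋ → ¬ (H ≡ H') → Chain ℋ (H ∪ H') H H'

  Move : List (Edge n) → Pos n → Pos n → Set
  Move ℋ x x' = ∃ λ H → H ∈ℋ ℋ
                  × (∀ i → i ∈ H → x' i < x i)
                  × (∀ i → i ∉ H → x' i ≡ x i)

  data Play (ℋ : List (Edge n)) : ℕ → Pos n → Set where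
    stop : ∀ {x} → Play ℋ zero x
    move : ∀ {k x x'} → Move ℋ x x' → Play ℋ k x' → Play ℋ (suc k) x

  Height : List (Edge n) → Pos n → ℕ → Set
  Height ℋ x h = Play ℋ h x × (∀ k → Play ℋ k x → k ≤ h)

  IsMin : Pos n → ℕ → Set
  IsMin x m = (∃ λ i → x i ≡ m) × (∀ i → m ≤ x i)

  shift : Pos n → ℕ → Pos n
  shift x m i = x i ∸ m

-- Write z = x − μe. A move from x to a position of minimum μ along an edge G is
-- the same as a position p with p = z off G, p < z on G and some p_j = 0 (take
-- x' = p + μe). Lowering one coordinate by one costs at most one move, so heights
-- take every value between those of the corners of the box
-- [z zeroed on G, z lowered by one on G]. Call G launchable if its box contains a
-- point with a zero coordinate and height ≥ η, and say that G overshoots if even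
-- the lower corner has height > η. A launchable edge either yields the move or
-- overshoots, and if G overshoots then every edge G' meeting G with |G' ∖ G| = 1
-- is launchable. So walking along a chain of (C) from a launchable edge to an
-- edge that does not overshoot produces the move.
-- If μ = m, start at the first edge of a longest play from z and stop at the
-- edge of (A) meeting every edge inside the support of z: zeroing it leaves no
-- move. If μ < m, start at an edge through a minimal coordinate i₀ and stop at
-- the edge of (A) meeting every edge avoiding i₀: after zeroing it every move
-- lowers coordinate i₀, so at most z i₀ = m − μ ≤ η moves remain.

module Submission where

open import Defs
open import Data.Bool using (if_then_else_)
open import Data.Bool.Properties using () renaming (_≟_ to _≟ᵇ_)
open import Data.Fin as Fin using (Fin; _≟_)
open import Data.Fin.Properties using (any?; all?)
open import Data.Fin.Subset using (Subset; _∈_; _∉_; _⊆_; _∪_; _─_; _-_; ∣_∣; ⁅_⁆; ∁)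
open import Data.Fin.Subset.Properties
  using (_∈?_; _⊆?_; nonempty?; Empty-unique; ∣⊥∣≡0; ∣⁅x⁆∣≡1; x∈⁅x⁆; x∈⁅y⁆⇒x≡y; x≢y⇒x∉⁅y⁆;
         x∈p⇒∣p-x∣<∣p∣; x∈p∧x≢y⇒x∈p-y; x∈p∧x∉q⇒x∈p─q; p⊆q⇒∣p∣≤∣q∣; q⊆p∪q; x∈p∪q⁻;
         x∈p⇒x∉∁p; x∉p⇒x∈∁p; p─q⊆p)
open import Data.List using (List)
open import Data.List.Membership.Propositional using (find; lose)
open import Data.List.Relation.Unary.Any using (Any) renaming (any? to anyEdge?)
open import Data.Nat using (ℕ; zero; suc; pred; _+_; _∸_; _≤_; _<_; z≤n; s≤s; _<?_)
open import Data.Nat.Induction using (<-wellFounded)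
open import Data.Nat.Properties renaming (_≟_ to _≟ℕ_)
open ≤-Reasoning using (begin_; begin-equality_; begin-strict_; _∎; step-≤; step-<; step-≡-⟩; step-≡-⟨)
open import Data.Product using (∃; _×_; _,_; proj₁; proj₂)
open import Data.Sum using (_⊎_; inj₁; inj₂)
open import Data.Vec using (tabulate)
open import Data.Vec.Functional.Relation.Binary.Pointwise using (Pointwise)
import Data.Vec.Functional.Relation.Binary.Pointwise.Properties as Pointwise
open import Data.Vec.Properties using (≡-dec; lookup∘tabulate; []=⇒lookup; lookup⇒[]=)
open import Function using (_∘_)
open import Induction.WellFounded using (Acc; acc)
open import Relation.Binary.PropositionalEquality using (_≡_; refl; sym; trans; cong; subst)
open import Relation.Nullary using (¬_; Dec; yes; no; does; contradiction)
open import Relation.Nullary.Decidable using (map′; _×-dec_; _→-dec_; dec-true; dec-false; toSum)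

private
  variable
    n k : ℕ
    i : Fin n
    G G' : Subset n
    v w : Pos n

infix 4 _≤ᵖ_
_≤ᵖ_ : Pos n → Pos n → Set
_≤ᵖ_ = Pointwise _≤_

≤ᵖ-refl : v ≤ᵖ v
≤ᵖ-refl = Pointwise.refl {R = _≤_} ≤-refl

≤ᵖ-trans : {u : Pos n} → u ≤ᵖ v → v ≤ᵖ w → u ≤ᵖ w
≤ᵖ-trans = Pointwise.trans {R = _≤_} ≤-trans

Positive : Subset n → Pos n → Set
Positive G w = ∀ i → i ∈ G → 0 < w i

zeroOn : Subset n → Pos n → Pos n
zeroOn G w i = if does (i ∈? G) then 0 else w i

decreaseOn : Subset n → Pos n → Pos n
decreaseOn G w i = if does (i ∈? G) then pred (w i) else w i

zeroOn-∈ : ∀ w → i ∈ G → zeroOn G w i ≡ 0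
zeroOn-∈ {i = i} {G = G} _ i∈G with i ∈? G
... | yes _ = refl
... | no i∉G = contradiction i∈G i∉G

zeroOn-∉ : ∀ w → i ∉ G → zeroOn G w i ≡ w i
zeroOn-∉ {i = i} {G = G} _ i∉G with i ∈? G
... | yes i∈G = contradiction i∈G i∉G
... | no _ = refl

decreaseOn-∈ : ∀ w → i ∈ G → decreaseOn G w i ≡ pred (w i)
decreaseOn-∈ {i = i} {G = G} _ i∈G with i ∈? G
... | yes _ = refl
... | no i∉G = contradiction i∈G i∉G

decreaseOn-∉ : ∀ w → i ∉ G → decreaseOn G w i ≡ w i
decreaseOn-∉ {i = i} {G = G} _ i∉G with i ∈? G
... | yes i∈G = contradiction i∈G i∉G
... | no _ = refl

zeroOn-≤ : zeroOn G w ≤ᵖ w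
zeroOn-≤ {G = G} i with i ∈? G
... | yes _ = z≤n
... | no _ = ≤-refl

decreaseOn-≤ : decreaseOn G w ≤ᵖ w
decreaseOn-≤ {G = G} i with i ∈? G
... | yes _ = pred[n]≤n
... | no _ = ≤-refl

pred≤decreaseOn : pred (w i) ≤ decreaseOn G w i
pred≤decreaseOn {i = i} {G = G} with i ∈? G
... | yes _ = ≤-refl
... | no _ = pred[n]≤n

zeroOn≤decreaseOn : zeroOn G w ≤ᵖ decreaseOn G w
zeroOn≤decreaseOn {G = G} i with i ∈? G
... | yes _ = z≤n
... | no _ = ≤-refl

decreaseOn-mono : v ≤ᵖ w → decreaseOn G v ≤ᵖ decreaseOn G w
decreaseOn-mono {G = G} v≤w i with i ∈? G
... | yes _ = pred-mono-≤ (v≤w i)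
... | no _ = v≤w i

≤decreaseOn : (∀ i → i ∈ G → v i < w i) → v ≤ᵖ w → v ≤ᵖ decreaseOn G w
≤decreaseOn {G = G} v<w v≤w i with i ∈? G
... | yes i∈G = <⇒≤pred (v<w i i∈G)
... | no _ = v≤w i

decreaseOn-comm : ∀ i → decreaseOn G (decreaseOn G' w) i ≡ decreaseOn G' (decreaseOn G w) i
decreaseOn-comm {G = G} {G' = G'} i with i ∈? G | i ∈? G'
... | yes _ | yes _ = refl
... | yes _ | no _ = refl
... | no _ | yes _ = refl
... | no _ | no _ = refl

decreaseOn-< : ∀ w → i ∈ G → 0 < w i → decreaseOn G w i < w i
decreaseOn-< w i∈G 0<wi = ≤-<-trans (≤-reflexive (decreaseOn-∈ w i∈G)) (pred< 0<wi)
  where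
  pred< : ∀ {m} → 0 < m → pred m < m
  pred< {suc m} _ = n<1+n m

decreaseOn-antimono : G ⊆ G' → decreaseOn G' w ≤ᵖ decreaseOn G w
decreaseOn-antimono {G = G} {w = w} G⊆G' i with toSum (i ∈? G)
... | inj₁ i∈G = ≤-reflexive (trans (decreaseOn-∈ w (G⊆G' i∈G)) (sym (decreaseOn-∈ w i∈G)))
... | inj₂ i∉G = ≤-trans (decreaseOn-≤ {w = w} i) (≤-reflexive (sym (decreaseOn-∉ w i∉G)))

zeroOn-antimono : G ⊆ G' → zeroOn G' w ≤ᵖ zeroOn G w
zeroOn-antimono {G = G} {w = w} G⊆G' i with toSum (i ∈? G)
... | inj₁ i∈G = ≤-reflexive (trans (zeroOn-∈ w (G⊆G' i∈G)) (sym (zeroOn-∈ w i∈G)))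
... | inj₂ i∉G = ≤-trans (zeroOn-≤ {w = w} i) (≤-reflexive (sym (zeroOn-∉ w i∉G)))

decreaseOn-zeroOn : decreaseOn (G' ─ G) (zeroOn G w) ≤ᵖ zeroOn G (decreaseOn G' w)
decreaseOn-zeroOn {G' = G'} {G = G} {w = w} i with toSum (i ∈? G) | toSum (i ∈? G')
... | inj₁ i∈G | _ = begin
  decreaseOn (G' ─ G) (zeroOn G w) i ≤⟨ decreaseOn-≤ {G = G' ─ G} {w = zeroOn G w} i ⟩
  zeroOn G w i                       ≡⟨ zeroOn-∈ w i∈G ⟩
  0                                  ≤⟨ z≤n ⟩
  zeroOn G (decreaseOn G' w) i       ∎
... | inj₂ i∉G | inj₁ i∈G' = ≤-reflexive (begin-equality
  decreaseOn (G' ─ G) (zeroOn G w) i ≡⟨ decreaseOn-∈ (zeroOn G w) (x∈p∧x∉q⇒x∈p─q i∈G' i∉G) ⟩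
  pred (zeroOn G w i)                ≡⟨ cong pred (zeroOn-∉ w i∉G) ⟩
  pred (w i)                         ≡⟨ decreaseOn-∈ w i∈G' ⟨
  decreaseOn G' w i                  ≡⟨ zeroOn-∉ (decreaseOn G' w) i∉G ⟨
  zeroOn G (decreaseOn G' w) i       ∎)
... | inj₂ i∉G | inj₂ i∉G' = ≤-reflexive (begin-equality
  decreaseOn (G' ─ G) (zeroOn G w) i ≡⟨ decreaseOn-∉ (zeroOn G w) (i∉G' ∘ p─q⊆p G' G) ⟩
  zeroOn G w i                       ≡⟨ zeroOn-∉ w i∉G ⟩
  w i                                ≡⟨ decreaseOn-∉ w i∉G' ⟨
  decreaseOn G' w i                  ≡⟨ zeroOn-∉ (decreaseOn G' w) i∉G ⟨
  zeroOn G (decreaseOn G' w) i       ∎)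

total : Pos n → ℕ
total {zero} _ = 0
total {suc n} w = w Fin.zero + total (w ∘ Fin.suc)

total-mono : v ≤ᵖ w → total v ≤ total w
total-mono {zero} _ = z≤n
total-mono {suc n} v≤w = +-mono-≤ (v≤w Fin.zero) (total-mono (v≤w ∘ Fin.suc))

total-mono-< : v ≤ᵖ w → v i < w i → total v < total w
total-mono-< {suc n} {i = Fin.zero} v≤w vi<wi = +-mono-<-≤ vi<wi (total-mono (v≤w ∘ Fin.suc))
total-mono-< {suc n} {i = Fin.suc i} v≤w vi<wi =
  +-mono-≤-< (v≤w Fin.zero) (total-mono-< {i = i} (v≤w ∘ Fin.suc) vi<wi)

support : Pos n → Subset n
support w = tabulate (λ i → does (0 <? w i))

∈support⁺ : ∀ w → 0 < w i → i ∈ support w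
∈support⁺ {i = i} w 0<wi = lookup⇒[]= i _ (trans (lookup∘tabulate _ i) (dec-true (0 <? w i) 0<wi))

∈support⁻ : ∀ w → i ∈ support w → 0 < w i
∈support⁻ {i = i} w i∈ with toSum (0 <? w i)
... | inj₁ 0<wi = 0<wi
... | inj₂ 0≮wi = contradiction
  (trans (sym (dec-false (0 <? w i) 0≮wi)) (trans (sym (lookup∘tabulate _ i)) ([]=⇒lookup i∈))) λ ()

x∈p⇒⁅x⁆⊆p : ∀ {p : Subset n} → i ∈ p → ⁅ i ⁆ ⊆ p
x∈p⇒⁅x⁆⊆p {i = i} {p = p} i∈p j∈⁅i⁆ = subst (_∈ p) (sym (x∈⁅y⁆⇒x≡y i j∈⁅i⁆)) i∈p

x∈p⇒1≤∣p∣ : ∀ {p : Subset n} → i ∈ p → 1 ≤ ∣ p ∣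
x∈p⇒1≤∣p∣ {i = i} {p = p} i∈p =
  subst (_≤ ∣ p ∣) (∣⁅x⁆∣≡1 i) (p⊆q⇒∣p∣≤∣q∣ (x∈p⇒⁅x⁆⊆p i∈p))

∣p∣≡1⇒p⊆⁅x⁆ : ∀ {p : Subset n} → ∣ p ∣ ≡ 1 → ∃ λ k → p ⊆ ⁅ k ⁆
∣p∣≡1⇒p⊆⁅x⁆ {n = n} {p = p} ∣p∣≡1 with nonempty? p
... | no empty =
  contradiction (trans (sym ∣p∣≡1) (trans (cong ∣_∣ (Empty-unique empty)) (∣⊥∣≡0 n))) λ ()
... | yes (k , k∈p) = k , λ {i} i∈p → subst (_∈ ⁅ k ⁆) (sym (unique i∈p)) (x∈⁅x⁆ k)
  where
  unique : i ∈ p → i ≡ k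
  unique {i = i} i∈p with i ≟ k
  ... | yes i≡k = i≡k
  ... | no i≢k = contradiction (x∈p⇒1≤∣p∣ (x∈p∧x≢y⇒x∈p-y i∈p i≢k))
                               (<⇒≱ (subst (∣ p - k ∣ <_) ∣p∣≡1 (x∈p⇒∣p-x∣<∣p∣ k∈p)))

module _ (ℋ : List (Subset n)) where

  greedyMove : ∀ {H} → H ∈ℋ ℋ → Positive H w → Move ℋ w (decreaseOn H w)
  greedyMove {w = w} {H} H∈ℋ H⁺ =
    H , H∈ℋ , (λ i i∈H → decreaseOn-< w i∈H (H⁺ i i∈H)) , (λ i → decreaseOn-∉ w)

  Move⇒≤greedy : Move ℋ v w → ∃ λ H → H ∈ℋ ℋ × Positive H v × w ≤ᵖ decreaseOn H v
  Move⇒≤greedy {v = v} {w = w} (H , H∈ℋ , lower , keep) =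
    H , H∈ℋ , (λ i i∈H → ≤-<-trans z≤n (lower i i∈H)) , ≤decreaseOn lower w≤v
    where
    w≤v : w ≤ᵖ v
    w≤v i with toSum (i ∈? H)
    ... | inj₁ i∈H = <⇒≤ (lower i i∈H)
    ... | inj₂ i∉H = ≤-reflexive (keep i i∉H)

  Play-mono : v ≤ᵖ w → Play ℋ k v → Play ℋ k w
  Play-mono v≤w stop = stop
  Play-mono v≤w (move mv play) with Move⇒≤greedy mv
  ... | H , H∈ℋ , H⁺ , v'≤ =
    move (greedyMove H∈ℋ (λ i i∈H → <-≤-trans (H⁺ i i∈H) (v≤w i)))
         (Play-mono (≤ᵖ-trans v'≤ (decreaseOn-mono v≤w)) play)

  Play-suc⇒greedy : Play ℋ (suc k) v
                  → ∃ λ H → H ∈ℋ ℋ × Positive H v × Play ℋ k (decreaseOn H v)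
  Play-suc⇒greedy (move mv play) with Move⇒≤greedy mv
  ... | H , H∈ℋ , H⁺ , v'≤ = H , H∈ℋ , H⁺ , Play-mono v'≤ play

  Play? : ∀ k v → Dec (Play ℋ k v)
  Play? zero v = yes stop
  Play? (suc k) v =
    map′ fromGreedy toGreedy (anyEdge? (λ H → positive? H ×-dec Play? k (decreaseOn H v)) ℋ)
    where
    GreedyStep : Subset n → Set
    GreedyStep H = Positive H v × Play ℋ k (decreaseOn H v)

    positive? : ∀ H → Dec (Positive H v)
    positive? H = all? (λ i → i ∈? H →-dec 0 <? v i)

    fromGreedy : Any GreedyStep ℋ → Play ℋ (suc k) v
    fromGreedy greedy with find greedy
    ... | H , H∈ℋ , H⁺ , play = move (greedyMove H∈ℋ H⁺) play

    toGreedy : Play ℋ (suc k) v → Any GreedyStep ℋ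
    toGreedy play with Play-suc⇒greedy play
    ... | H , H∈ℋ , greedy = lose H∈ℋ greedy

  Play-≤ : ∀ {j} → k ≤ j → Play ℋ j v → Play ℋ k v
  Play-≤ z≤n _ = stop
  Play-≤ (s≤s k≤j) (move mv play) = move mv (Play-≤ k≤j play)

  Height-intro : ∀ {η} → Play ℋ η v → ¬ Play ℋ (suc η) v → Height ℋ v η
  Height-intro play ¬play = play , λ k playₖ → ≮⇒≥ (λ η<k → ¬play (Play-≤ η<k playₖ))

  Height-cong : ∀ {η} → (∀ i → v i ≡ w i) → Height ℋ v η → Height ℋ w η
  Height-cong v≡w (play , bound) =
    Play-mono (≤-reflexive ∘ v≡w) play , λ k → bound k ∘ Play-mono (≤-reflexive ∘ sym ∘ v≡w)

  Play-decreaseAt : ∀ {k} j → Play ℋ (suc k) v → Play ℋ k (decreaseOn ⁅ j ⁆ v)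
  Play-decreaseAt {k = zero} _ _ = stop
  Play-decreaseAt {v = v} {k = suc k} j play with Play-suc⇒greedy play
  ... | H , H∈ℋ , H⁺ , rest with toSum (j ∈? H)
  ...   | inj₁ j∈H = Play-mono (decreaseOn-antimono (x∈p⇒⁅x⁆⊆p j∈H)) rest
  ...   | inj₂ j∉H =
    move (greedyMove H∈ℋ H⁺′) (Play-mono (≤-reflexive ∘ decreaseOn-comm) (Play-decreaseAt j rest))
    where
    H⁺′ : Positive H (decreaseOn ⁅ j ⁆ v)
    H⁺′ i i∈H = subst (0 <_) (sym (decreaseOn-∉ v (x≢y⇒x∉⁅y⁆ λ { refl → j∉H i∈H }))) (H⁺ i i∈H)

  Height-between : ∀ {η lo hi} → lo ≤ᵖ hi → ¬ Play ℋ (suc η) lo → Play ℋ η hi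
           → ∃ λ p → lo ≤ᵖ p × p ≤ᵖ hi × Height ℋ p η
  Height-between {η = η} {lo} {hi} lo≤hi ¬lo = descend hi (<-wellFounded (total hi)) lo≤hi
    where
    descend : ∀ hi → Acc _<_ (total hi) → lo ≤ᵖ hi → Play ℋ η hi
            → ∃ λ p → lo ≤ᵖ p × p ≤ᵖ hi × Height ℋ p η
    descend hi (acc smaller) lo≤hi play with Play? (suc η) hi
    ... | no ¬play = hi , lo≤hi , ≤ᵖ-refl , Height-intro play ¬play
    ... | yes play⁺ with any? (λ i → lo i <? hi i)
    ...   | no lo≮hi = contradiction (Play-mono (λ i → ≮⇒≥ (λ lo<hi → lo≮hi (i , lo<hi))) play⁺) ¬lo
    ...   | yes (i , loᵢ<hiᵢ)
      with descend (decreaseOn ⁅ i ⁆ hi) (smaller hi⁻<hi) lo≤hi⁻ (Play-decreaseAt i play⁺)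
      where
      hi⁻<hi : total (decreaseOn ⁅ i ⁆ hi) < total hi
      hi⁻<hi = total-mono-< (decreaseOn-≤ {w = hi}) (decreaseOn-< hi (x∈⁅x⁆ i) (≤-<-trans z≤n loᵢ<hiᵢ))
      lo≤hi⁻ : lo ≤ᵖ decreaseOn ⁅ i ⁆ hi
      lo≤hi⁻ = ≤decreaseOn (λ j j∈⁅i⁆ → subst (λ j → lo j < hi j) (sym (x∈⁅y⁆⇒x≡y i j∈⁅i⁆)) loᵢ<hiᵢ)
                           lo≤hi
    ...     | p , lo≤p , p≤hi⁻ , height = p , lo≤p , ≤ᵖ-trans p≤hi⁻ decreaseOn-≤ , height

  Play-length≤ : ∀ {Z i₀} → (∀ i → i ∈ Z → v i ≡ 0) → (∀ G → G ∈ℋ ℋ → i₀ ∉ G → Meets Z G)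
               → Play ℋ k v → k ≤ v i₀
  Play-length≤ {k = zero} _ _ _ = z≤n
  Play-length≤ {v = v} {k = suc k} {Z} {i₀} Z-zero avoid-meets play with Play-suc⇒greedy play
  ... | G , G∈ℋ , G⁺ , rest =
    ≤-<-trans (Play-length≤ Z-zero′ avoid-meets rest) (decreaseOn-< v i₀∈G (G⁺ i₀ i₀∈G))
    where
    Z∩G-empty : ∀ {i} → i ∈ Z → i ∉ G
    Z∩G-empty i∈Z i∈G = contradiction (Z-zero _ i∈Z) (n>0⇒n≢0 (G⁺ _ i∈G))
    i₀∈G : i₀ ∈ G
    i₀∈G with toSum (i₀ ∈? G)
    ... | inj₁ i₀∈G = i₀∈G
    ... | inj₂ i₀∉G =
      let (i , i∈Z , i∈G) = avoid-meets G G∈ℋ i₀∉G in contradiction i∈G (Z∩G-empty i∈Z)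
    Z-zero′ : ∀ i → i ∈ Z → decreaseOn G v i ≡ 0
    Z-zero′ i i∈Z = trans (decreaseOn-∉ v (Z∩G-empty i∈Z)) (Z-zero i i∈Z)

  -- Sweeping along a chain of edges

  chain-walk : ∀ {U A B} {Goal : Set} (P Q : Subset n → Set)
             → (∀ {G} → G ∈ℋ ℋ → G ⊆ U → P G → Goal ⊎ Q G)
             → (∀ {G G'} → Meets G' G → ∣ G' ─ G ∣ ≡ 1 → Q G → P G')
             → B ∈ℋ ℋ → B ⊆ U → ¬ Q B → Chain ℋ U A B → P A → Goal
  chain-walk P Q finish-or-Q Q⇒P B∈ℋ B⊆U ¬QB done PB with finish-or-Q B∈ℋ B⊆U PB
  ... | inj₁ goal = goal
  ... | inj₂ QB = contradiction QB ¬QB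
  chain-walk P Q finish-or-Q Q⇒P B∈ℋ B⊆U ¬QB (step A∈ℋ _ A⊆U meets ∣A'─A∣≡1 chain) PA
    with finish-or-Q A∈ℋ A⊆U PA
  ... | inj₁ goal = goal
  ... | inj₂ QA = chain-walk P Q finish-or-Q Q⇒P B∈ℋ B⊆U ¬QB chain (Q⇒P meets ∣A'─A∣≡1 QA)

  PropC⇒Chain : PropC ℋ → ∀ {H H'} → H ∈ℋ ℋ → H' ∈ℋ ℋ → Chain ℋ (H ∪ H') H H'
  PropC⇒Chain propC {H} {H'} H∈ℋ H'∈ℋ with ≡-dec _≟ᵇ_ H H'
  ... | yes refl = done
  ... | no H≢H' = propC H H' H∈ℋ H'∈ℋ H≢H'

  HasMoveTo : Pos n → ℕ → ℕ → Set
  HasMoveTo x μ η = ∃ λ x' → Move ℋ x x' × IsMin x' μ × Height ℋ (shift x' μ) η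

  module Sweep (x : Pos n) (μ : ℕ) (μ≤x : ∀ i → μ ≤ x i) (η : ℕ) where

    z : Pos n
    z = shift x μ

    Box : Subset n → Pos n → Set
    Box G h = zeroOn G z ≤ᵖ h × h ≤ᵖ decreaseOn G z

    Launchable : Subset n → Set
    Launchable G = ∃ λ h → Box G h × (∃ λ j → h j ≡ 0) × Play ℋ η h

    Overshoots : Subset n → Set
    Overshoots G = Play ℋ (suc η) (zeroOn G z)

    Box-∉ : ∀ {G p i} → Box G p → i ∉ G → p i ≡ z i
    Box-∉ {i = i} (lo≤p , p≤hi) i∉G =
      ≤-antisym (≤-trans (p≤hi i) (≤-reflexive (decreaseOn-∉ z i∉G)))
                (≤-trans (≤-reflexive (sym (zeroOn-∉ z i∉G))) (lo≤p i))

    Box⇒HasMoveTo : ∀ {G p} → G ∈ℋ ℋ → Positive G z → Box G p → (∃ λ j → p j ≡ 0)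
                  → Height ℋ p η → HasMoveTo x μ η
    Box⇒HasMoveTo {G} {p} G∈ℋ G⁺ box (j , pⱼ≡0) height =
      (λ i → p i + μ) , (G , G∈ℋ , lower , keep) ,
      ((j , cong (_+ μ) pⱼ≡0) , (λ i → m≤n+m μ (p i))) ,
      Height-cong (λ i → sym (m+n∸n≡m (p i) μ)) height
      where
      lower : ∀ i → i ∈ G → p i + μ < x i
      lower i i∈G = begin-strict
        p i + μ  <⟨ +-monoˡ-< μ (≤-<-trans (proj₂ box i) (decreaseOn-< z i∈G (G⁺ i i∈G))) ⟩
        z i + μ  ≡⟨ m∸n+n≡m (μ≤x i) ⟩
        x i      ∎
      keep : ∀ i → i ∉ G → p i + μ ≡ x i
      keep i i∉G = trans (cong (_+ μ) (Box-∉ box i∉G)) (m∸n+n≡m (μ≤x i))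

    launchable⇒move⊎overshoots : ∀ {G} → G ∈ℋ ℋ → Positive G z → Launchable G
                               → HasMoveTo x μ η ⊎ Overshoots G
    launchable⇒move⊎overshoots {G} G∈ℋ G⁺ (h , (lo≤h , h≤hi) , (j , hⱼ≡0) , play)
      with Play? (suc η) (zeroOn G z)
    ... | yes over = inj₂ over
    ... | no ¬over with Height-between lo≤h ¬over play
    ...   | p , lo≤p , p≤h , height =
      inj₁ (Box⇒HasMoveTo G∈ℋ G⁺ (lo≤p , ≤ᵖ-trans p≤h h≤hi)
                          (j , n≤0⇒n≡0 (≤-trans (p≤h j) (≤-reflexive hⱼ≡0))) height)

    launchableAt : ∀ {G j} → j ∈ G → Play ℋ η (zeroOn ⁅ j ⁆ (decreaseOn G z)) → Launchable G
    launchableAt {G} {j} j∈G play =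
      zeroOn ⁅ j ⁆ (decreaseOn G z) , (lo≤h , zeroOn-≤) , (j , zeroOn-∈ (decreaseOn G z) (x∈⁅x⁆ j)) , play
      where
      lo≤h : zeroOn G z ≤ᵖ zeroOn ⁅ j ⁆ (decreaseOn G z)
      lo≤h i with toSum (i ∈? ⁅ j ⁆)
      ... | inj₁ i∈⁅j⁆ =
        ≤-reflexive (trans (zeroOn-∈ z (x∈p⇒⁅x⁆⊆p j∈G i∈⁅j⁆)) (sym (zeroOn-∈ (decreaseOn G z) i∈⁅j⁆)))
      ... | inj₂ i∉⁅j⁆ =
        ≤-trans (zeroOn≤decreaseOn {w = z} i) (≤-reflexive (sym (zeroOn-∉ (decreaseOn G z) i∉⁅j⁆)))

    overshoots⇒launchable : ∀ {G G'} → Meets G' G → ∣ G' ─ G ∣ ≡ 1 → Overshoots G → Launchable G'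
    overshoots⇒launchable {G} {G'} (j , j∈G' , j∈G) ∣G'─G∣≡1 over with ∣p∣≡1⇒p⊆⁅x⁆ ∣G'─G∣≡1
    ... | k , G'─G⊆⁅k⁆ = launchableAt j∈G' (Play-mono below (Play-decreaseAt k over))
      where
      below : decreaseOn ⁅ k ⁆ (zeroOn G z) ≤ᵖ zeroOn ⁅ j ⁆ (decreaseOn G' z)
      below = ≤ᵖ-trans (decreaseOn-antimono G'─G⊆⁅k⁆)
                       (≤ᵖ-trans decreaseOn-zeroOn (zeroOn-antimono (x∈p⇒⁅x⁆⊆p j∈G)))

    sweep : ∀ {U A B} → Positive U z → B ∈ℋ ℋ → B ⊆ U → ¬ Overshoots B → Chain ℋ U A B
          → Launchable A → HasMoveTo x μ η
    sweep U⁺ = chain-walk Launchable Overshoots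
      (λ G∈ℋ G⊆U → launchable⇒move⊎overshoots G∈ℋ (λ i → U⁺ i ∘ G⊆U)) overshoots⇒launchable

  sameMinimum : ∀ {x m y η} → PropA ℋ → PropC ℋ → IsMin x m → Play ℋ y (shift x m) → η < y
              → HasMoveTo x m η
  sameMinimum {x} {m} {η = η} propA propC ((i₀ , xᵢ₀≡m) , m≤x) play η<y
    with Play-suc⇒greedy (Play-≤ η<y play)
  ... | H , H∈ℋ , H⁺ , rest =
    finish (proj₂ propA (support z) (i₀ , i₀∉P) (H , H∈ℋ , λ {i} → ∈support⁺ z ∘ H⁺ i))
    where
    open Sweep x m m≤x η

    zᵢ₀≡0 : z i₀ ≡ 0
    zᵢ₀≡0 = trans (cong (_∸ m) xᵢ₀≡m) (n∸n≡0 m)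

    i₀∉P : i₀ ∉ support z
    i₀∉P i₀∈P = contradiction zᵢ₀≡0 (n>0⇒n≢0 (∈support⁻ z i₀∈P))

    finish : (∃ λ E → E ∈ℋ ℋ × E ⊆ support z × (∀ G → G ∈ℋ ℋ → G ⊆ support z → Meets E G))
           → HasMoveTo x m η
    finish (E , E∈ℋ , E⊆P , E-meets) =
      sweep H∪E⁺ E∈ℋ (q⊆p∪q H E) ¬overE (PropC⇒Chain propC H∈ℋ E∈ℋ)
            (decreaseOn H z , (zeroOn≤decreaseOn , ≤ᵖ-refl) ,
             (i₀ , n≤0⇒n≡0 (≤-trans (decreaseOn-≤ {w = z} i₀) (≤-reflexive zᵢ₀≡0))) , rest)
      where
      H∪E⁺ : Positive (H ∪ E) z
      H∪E⁺ i i∈H∪E with x∈p∪q⁻ H E i∈H∪E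
      ... | inj₁ i∈H = H⁺ i i∈H
      ... | inj₂ i∈E = ∈support⁻ z (E⊆P i∈E)

      ¬overE : ¬ Overshoots E
      ¬overE over with Play-suc⇒greedy over
      ... | G , G∈ℋ , G⁺ , _
        with E-meets G G∈ℋ (λ {i} i∈G → ∈support⁺ z (≤-trans (G⁺ i i∈G) (zeroOn-≤ {G = E} {w = z} i)))
      ...   | i , i∈E , i∈G = contradiction (zeroOn-∈ z i∈E) (n>0⇒n≢0 (G⁺ i i∈G))

  smallerMinimum : ∀ {x m y μ η} → IsHypergraph ℋ → PropA ℋ → PropC ℋ → IsMin x m
                 → Play ℋ y (shift x m) → μ < m → m ∸ μ ≤ η → η ≤ y → HasMoveTo x μ η
  smallerMinimum {x} {m} {y} {μ} {η} (_ , covers) propA propC ((i₀ , xᵢ₀≡m) , m≤x) play μ<m m∸μ≤η η≤y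
    with covers i₀
  ... | H , H∈ℋ , i₀∈H = finish (proj₂ propA (∁ ⁅ i₀ ⁆) (i₀ , x∈p⇒x∉∁p (x∈⁅x⁆ i₀)) edgeAvoiding)
    where
    μ<x : ∀ i → μ < x i
    μ<x i = <-≤-trans μ<m (m≤x i)

    open Sweep x μ (<⇒≤ ∘ μ<x) η

    avoiding⇒⊆ : ∀ {G} → i₀ ∉ G → G ⊆ ∁ ⁅ i₀ ⁆
    avoiding⇒⊆ {G} i₀∉G {i} i∈G =
      x∉p⇒x∈∁p (λ i∈⁅i₀⁆ → i₀∉G (subst (_∈ G) (x∈⁅y⁆⇒x≡y i₀ i∈⁅i₀⁆) i∈G))

    edgeAvoiding : ∃ λ G → G ∈ℋ ℋ × G ⊆ ∁ ⁅ i₀ ⁆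
    edgeAvoiding with anyEdge? (_⊆? ∁ ⁅ i₀ ⁆) ℋ
    ... | yes some = find some
    ... | no none = contradiction (H , H∈ℋ , λ G G∈ℋ → i₀ , i₀∈H , i₀∈ G G∈ℋ) (proj₁ propA)
      where
      i₀∈ : ∀ G → G ∈ℋ ℋ → i₀ ∈ G
      i₀∈ G G∈ℋ with toSum (i₀ ∈? G)
      ... | inj₁ i₀∈G = i₀∈G
      ... | inj₂ i₀∉G = contradiction (lose G∈ℋ (λ {i} → avoiding⇒⊆ i₀∉G {i})) none

    shift≤launchPoint : shift x m ≤ᵖ zeroOn ⁅ i₀ ⁆ (decreaseOn H z)
    shift≤launchPoint i with toSum (i ∈? ⁅ i₀ ⁆)
    ... | inj₁ i∈⁅i₀⁆ rewrite x∈⁅y⁆⇒x≡y i₀ i∈⁅i₀⁆ =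
      ≤-trans (≤-reflexive (trans (cong (_∸ m) xᵢ₀≡m) (n∸n≡0 m))) z≤n
    ... | inj₂ i∉⁅i₀⁆ = begin
      x i ∸ m                              ≤⟨ ∸-monoʳ-≤ (x i) μ<m ⟩
      x i ∸ suc μ                          ≡⟨ pred[m∸n]≡m∸[1+n] (x i) μ ⟨
      pred (z i)                           ≤⟨ pred≤decreaseOn {w = z} ⟩
      decreaseOn H z i                     ≡⟨ zeroOn-∉ (decreaseOn H z) i∉⁅i₀⁆ ⟨
      zeroOn ⁅ i₀ ⁆ (decreaseOn H z) i     ∎

    finish : (∃ λ E → E ∈ℋ ℋ × E ⊆ ∁ ⁅ i₀ ⁆ × (∀ G → G ∈ℋ ℋ → G ⊆ ∁ ⁅ i₀ ⁆ → Meets E G))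
           → HasMoveTo x μ η
    finish (E , E∈ℋ , E⊆S , E-meets) =
      sweep (λ i _ → m<n⇒0<n∸m (μ<x i)) E∈ℋ (q⊆p∪q H E) ¬overE (PropC⇒Chain propC H∈ℋ E∈ℋ)
            (launchableAt i₀∈H (Play-mono shift≤launchPoint (Play-≤ η≤y play)))
      where
      ¬overE : ¬ Overshoots E
      ¬overE over = <-irrefl refl (begin-strict
        η                <⟨ Play-length≤ (λ i → zeroOn-∈ z) (λ G G∈ℋ → E-meets G G∈ℋ ∘ avoiding⇒⊆) over ⟩
        zeroOn E z i₀    ≡⟨ zeroOn-∉ z (λ i₀∈E → x∈p⇒x∉∁p (x∈⁅x⁆ i₀) (E⊆S i₀∈E)) ⟩
        x i₀ ∸ μ         ≡⟨ cong (_∸ μ) xᵢ₀≡m ⟩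
        m ∸ μ            ≤⟨ m∸μ≤η ⟩
        η                ∎)

lemma4 : (n : ℕ) (ℋ : List (Subset n)) → IsHypergraph ℋ → PropA ℋ → PropC ℋ
       → (x : Pos n) (m y : ℕ) → IsMin x m → Height ℋ (shift x m) y → 0 < m
       → (μ η : ℕ) → ¬ ((μ ≡ m) × (η ≡ y)) → μ ≤ m → m ∸ μ ≤ η → η ≤ y
       → ∃ λ x' → Move ℋ x x' × IsMin x' μ × Height ℋ (shift x' μ) η
lemma4 n ℋ hyp propA propC x m y min (play , _) _ μ η ≢ μ≤m m∸μ≤η η≤y with μ ≟ℕ m
... | yes refl = sameMinimum ℋ propA propC min play (≤∧≢⇒< η≤y (λ η≡y → ≢ (refl , η≡y)))
... | no μ≢m = smallerMinimum ℋ hyp propA propC min play (≤∧≢⇒< μ≤m μ≢m) m∸μ≤η η≤y
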